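{- Let $G$ be a nontrivial connected graph of order $n$ with girth $g\ge 6$, minimum degree $\delta\ge 2$ and maximum degree $\Delta$, such that $\gamma_{tR2}(G)=n+2-(\Delta+\delta)$. Then for every vertex $u$ of degree $\Delta$, every neighbor $v$ of $u$ has degree $\delta$.
   Context: All graphs are finite and simple. For $f:V(G)\to\{0,1,2\}$ let $V_i=\{v:f(v)=i\}$; $f$ is a total Roman $\{2\}$-dominating function (TR2DF) if every vertex $v$ with $f(v)=0$ has a neighbor $u$ with $f(u)=2$ or two distinct neighbors $x,y$ with $f(x)=f(y)=1$, and the subgraph induced by $V_1\cup V_2$ has no isolated vertices. $\gamma_{tR2}(G)$ is the minimum weight $\sum_v f(v)$ of a TR2DF of $G$. -}

module Defs where

open import Data.Nat using (ℕ; zero; suc; _+_; _≤_; _<_)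
open import Data.Fin using (Fin; zero; suc; toℕ; inject₁; fromℕ)
open import Data.Bool using (Bool; true; false; if_then_else_)
open import Data.List using (List; map; allFin)
open import Data.Nat.ListAction using (sum)
open import Data.Empty using (⊥)
open import Data.Product using (Σ; ∃; ∃-syntax; _×_; _,_)
open import Data.Sum using (_⊎_)
open import Relation.Binary.PropositionalEquality using (_≡_; _≢_)
open import Relation.Nullary using (¬_)
open import Function.Definitions using (Injective)

record Graph (n : ℕ) : Set where
  field
    adj    : Fin n → Fin n → Bool
    sym    : ∀ u v → adj u v ≡ adj v u
    irrefl : ∀ v → adj v v ≡ false

open Graph public

Edge : ∀ {n} → Graph n → Fin n → Fin n → Set
Edge G u v = adj G u v ≡ true

deg : ∀ {n} → Graph n → Fin n → ℕ
deg {n} G v = sum (map (λ u → if adj G v u then 1 else 0) (allFin n))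

IsMinDegree : ∀ {n} → Graph n → ℕ → Set
IsMinDegree G δ = (∀ v → δ ≤ deg G v) × ∃[ v ] deg G v ≡ δ

IsMaxDegree : ∀ {n} → Graph n → ℕ → Set
IsMaxDegree G Δ = (∀ v → deg G v ≤ Δ) × ∃[ v ] deg G v ≡ Δ

data Walk {n} (G : Graph n) : Fin n → Fin n → Set where
  here : ∀ {v} → Walk G v v
  step : ∀ {u w v} → Edge G u w → Walk G w v → Walk G u v

Connected : ∀ {n} → Graph n → Set
Connected G = ∀ u v → Walk G u v

HasCycle : ∀ {n} → Graph n → ℕ → Set
HasCycle {n} G zero = ⊥
HasCycle {n} G (suc m) =
  Σ (Fin (suc m) → Fin n) λ c →
    Injective _≡_ _≡_ c ×
    (∀ (i : Fin m) → Edge G (c (inject₁ i)) (c (suc i))) ×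
    Edge G (c (fromℕ m)) (c zero)

GirthAtLeast : ∀ {n} → Graph n → ℕ → Set
GirthAtLeast G g = ∀ k → 3 ≤ k → k < g → ¬ HasCycle G k

weight : ∀ {n} → (Fin n → Fin 3) → ℕ
weight {n} f = sum (map (λ v → toℕ (f v)) (allFin n))

IsTR2DF : ∀ {n} → Graph n → (Fin n → Fin 3) → Set
IsTR2DF {n} G f =
  (∀ v → f v ≡ zero →
     (∃[ u ] Edge G v u × f u ≡ suc (suc zero))
     ⊎ (∃[ x ] ∃[ y ] x ≢ y × Edge G v x × Edge G v y ×
          f x ≡ suc zero × f y ≡ suc zero))
  × (∀ v → f v ≢ zero → ∃[ u ] Edge G v u × f u ≢ zero)

IsGammaTR2 : ∀ {n} → Graph n → ℕ → Set
IsGammaTR2 G w =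
  (∃[ f ] IsTR2DF G f × weight f ≡ w)
  × (∀ f → IsTR2DF G f → w ≤ weight f)

{-# OPTIONS --safe #-}
module Submission where

open import Defs
open import Data.Nat using (ℕ; _+_; _≤_; zero; suc; z≤n)
open import Data.Nat.Properties
  using (+-0-commutativeMonoid; ≤-refl; ≤-trans; ≤-antisym; ≤-reflexive; m≤n+m;
         +-mono-≤; +-monoˡ-≤; +-cancelˡ-≤; ≤⇒≯; module ≤-Reasoning)
open import Data.Fin using (Fin; zero; suc; toℕ; inject₁; fromℕ; _≟_)
open import Data.Fin.Patterns using (0F; 1F; 2F; 3F)
open import Data.Fin.Properties using (any?)
open import Data.Bool using (Bool; true; false; if_then_else_)
import Data.Bool as Bool
open import Data.Bool.Properties using (not-¬)
open import Data.List using (map; allFin; tabulate)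
open import Data.List.Properties using (map-tabulate)
import Data.Nat.ListAction as List
open import Data.Vec using (Vec; []; _∷_; lookup)
open import Data.Vec.Relation.Unary.All using ([]; _∷_)
open import Data.Vec.Relation.Unary.AllPairs using ([]; _∷_)
open import Data.Vec.Relation.Unary.Unique.Propositional using (Unique)
open import Data.Vec.Relation.Unary.Unique.Propositional.Properties using (lookup-injective)
open import Algebra.Properties.CommutativeMonoid.Sum +-0-commutativeMonoid
  using (sum-syntax; ∑-distrib-+; sum-cong-≗; sum-replicate-zero)
  renaming (sum to ∑)
open import Data.Empty using (⊥; ⊥-elim)
open import Data.Product using (∃-syntax; _×_; _,_)
open import Data.Sum using (_⊎_; inj₁; inj₂)
open import Function using (_∘_; id)
open import Relation.Binary.PropositionalEquality
  using (_≡_; _≢_; ≢-sym; refl; trans; cong; cong₂; module ≡-Reasoning)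
import Relation.Binary.PropositionalEquality as ≡
open import Relation.Nullary using (¬_; Dec; yes; no; ¬?; does; contradiction)
open import Relation.Nullary.Decidable using (_×-dec_; _⊎-dec_)

-- For any edge uv, let f be 0 on (N(u) ∪ N(v)) − {u, v} and 1 elsewhere. As G has no
-- triangles, N(u) − {v} and N(v) − {u} are disjoint, so f has weight n + 2 − deg u − deg v.
-- It is a TR2DF: a vertex w ∈ N(u) − {v} sees u and, having degree ≥ 2, a neighbour
-- y ≠ u that would close a 3- or 4-cycle if it were adjacent to u or v; a vertex
-- outside N(u) ∪ N(v) has two neighbours, which cannot both lie in N(u) ∪ N(v)
-- without closing a 4- or 5-cycle. Hence γ_tR2 ≤ n + 2 − Δ − deg v for deg u = Δ,
-- which with the hypothesis forces deg v ≤ δ.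

𝟙 : Bool → ℕ
𝟙 b = if b then 1 else 0

sum-tabulate : ∀ {n} (g : Fin n → ℕ) → List.sum (tabulate g) ≡ ∑ g
sum-tabulate {zero}  g = refl
sum-tabulate {suc n} g = cong (g zero +_) (sum-tabulate (g ∘ suc))

sum-map-allFin : ∀ {n} (g : Fin n → ℕ) → List.sum (map g (allFin n)) ≡ ∑ g
sum-map-allFin g = trans (cong List.sum (map-tabulate id g)) (sum-tabulate g)

∑-const-1 : ∀ n → ∑[ i < n ] 1 ≡ n
∑-const-1 zero    = refl
∑-const-1 (suc n) = cong suc (∑-const-1 n)

∑-indicator : ∀ {n} (x : Fin n) → ∑[ i < n ] 𝟙 (does (i ≟ x)) ≡ 1
∑-indicator {suc n} zero    = cong suc (sum-replicate-zero n)
∑-indicator         (suc x) = ∑-indicator x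

∑-mono-≤ : ∀ {n} {g h : Fin n → ℕ} → (∀ i → g i ≤ h i) → ∑ g ≤ ∑ h
∑-mono-≤ {zero}  g≤h = ≤-refl
∑-mono-≤ {suc n} g≤h = +-mono-≤ (g≤h zero) (∑-mono-≤ (g≤h ∘ suc))

∑-distrib-+₃ : ∀ {n} (g h k : Fin n → ℕ) →
               ∑[ i < n ] (g i + (h i + k i)) ≡ ∑ g + (∑ h + ∑ k)
∑-distrib-+₃ g h k = trans (∑-distrib-+ g _) (cong (∑ g +_) (∑-distrib-+ h k))

module _ {n : ℕ} (G : Graph n) where

  deg≡∑ : ∀ v → deg G v ≡ ∑[ w < n ] 𝟙 (adj G v w)
  deg≡∑ v = sum-map-allFin (λ w → 𝟙 (adj G v w))

  edge? : ∀ a b → Dec (Edge G a b)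
  edge? a b = adj G a b Bool.≟ true

  edge-sym : ∀ {a b} → Edge G a b → Edge G b a
  edge-sym {a} {b} ab = trans (Graph.sym G b a) ab

  edge-≢ : ∀ {a b} → Edge G a b → a ≢ b
  edge-≢ {a} ab refl = not-¬ (irrefl G a) ab

  non-neighbour-≢ : ∀ {a b c} → ¬ Edge G a b → Edge G a c → b ≢ c
  non-neighbour-≢ ¬ab ac refl = ¬ab ac

  other-neighbour : ∀ {w} → 2 ≤ deg G w → ∀ x → ∃[ y ] Edge G w y × y ≢ x
  other-neighbour {w} 2≤deg x with any? (λ y → edge? w y ×-dec ¬? (y ≟ x))
  ... | yes found = found
  ... | no none   = contradiction 2≤deg (≤⇒≯ deg≤1)
    where
    neighbours-are-x : ∀ y → 𝟙 (adj G w y) ≤ 𝟙 (does (y ≟ x))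
    neighbours-are-x y with adj G w y in wy | y ≟ x
    ... | false | _        = z≤n
    ... | true  | yes _    = ≤-refl
    ... | true  | no y≢x   = contradiction (y , wy , y≢x) none

    deg≤1 : deg G w ≤ 1
    deg≤1 = ≤-trans (≤-reflexive (deg≡∑ w))
              (≤-trans (∑-mono-≤ neighbours-are-x) (≤-reflexive (∑-indicator x)))

  cycle : ∀ {m} (c : Vec (Fin n) (suc m)) → Unique c →
          (∀ i → Edge G (lookup c (inject₁ i)) (lookup c (suc i))) →
          Edge G (lookup c (fromℕ m)) (lookup c zero) → HasCycle G (suc m)
  cycle c distinct path closing =
    lookup c , (λ {i} {j} → lookup-injective distinct i j) , path , closing

  GirthAtLeast-mono : ∀ {g h} → g ≤ h → GirthAtLeast G h → GirthAtLeast G g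
  GirthAtLeast-mono g≤h girth k 3≤k k<g = girth k 3≤k (≤-trans k<g g≤h)

  no-triangle : GirthAtLeast G 4 → ∀ {a b c} →
                Edge G a b → Edge G b c → Edge G c a → ⊥
  no-triangle girth {a} {b} {c} ab bc ca = girth 3 ≤-refl ≤-refl
    (cycle (a ∷ b ∷ c ∷ [])
      ((edge-≢ ab ∷ edge-≢ (edge-sym ca) ∷ []) ∷ (edge-≢ bc ∷ []) ∷ [] ∷ [])
      (λ { 0F → ab ; 1F → bc })
      ca)

  common-neighbour-unique : GirthAtLeast G 5 → ∀ {a b y₁ y₂} → a ≢ b →
                            Edge G a y₁ → Edge G y₁ b → Edge G a y₂ → Edge G y₂ b → y₁ ≡ y₂
  common-neighbour-unique girth {a} {b} {y₁} {y₂} a≢b ay₁ y₁b ay₂ y₂b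
    with y₁ ≟ y₂
  ... | yes y₁≡y₂ = y₁≡y₂
  ... | no  y₁≢y₂ = ⊥-elim (girth 4 (m≤n+m 3 1) ≤-refl
    (cycle (a ∷ y₁ ∷ b ∷ y₂ ∷ [])
      ((edge-≢ ay₁ ∷ a≢b ∷ edge-≢ ay₂ ∷ []) ∷ (edge-≢ y₁b ∷ y₁≢y₂ ∷ []) ∷
       (edge-≢ (edge-sym y₂b) ∷ []) ∷ [] ∷ [])
      (λ { 0F → ay₁ ; 1F → y₁b ; 2F → edge-sym y₂b })
      (edge-sym ay₂)))

  no-pentagon : GirthAtLeast G 6 → ∀ {a b c d e} →
                Edge G a b → Edge G b c → Edge G c d → Edge G d e → Edge G e a →
                a ≢ c → a ≢ d → b ≢ d → b ≢ e → c ≢ e → ⊥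
  no-pentagon girth {a} {b} {c} {d} {e} ab bc cd de ea a≢c a≢d b≢d b≢e c≢e =
    girth 5 (m≤n+m 3 2) ≤-refl
      (cycle (a ∷ b ∷ c ∷ d ∷ e ∷ [])
        ((edge-≢ ab ∷ a≢c ∷ a≢d ∷ edge-≢ (edge-sym ea) ∷ []) ∷
         (edge-≢ bc ∷ b≢d ∷ b≢e ∷ []) ∷ (edge-≢ cd ∷ c≢e ∷ []) ∷ (edge-≢ de ∷ []) ∷ [] ∷ [])
        (λ { 0F → ab ; 1F → bc ; 2F → cd ; 3F → de })
        ea)

  far-neighbour-of-near : GirthAtLeast G 5 → ∀ {a b w} → 2 ≤ deg G w →
                          Edge G a b → Edge G a w → w ≢ b →
                          ∃[ y ] Edge G w y × y ≢ a × ¬ Edge G a y × ¬ Edge G b y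
  far-neighbour-of-near girth {a} {b} {w} 2≤deg ab aw w≢b
    with y , wy , y≢a ← other-neighbour 2≤deg a
    = y , wy , y≢a , ¬ay , ¬by
    where
    ¬ay : ¬ Edge G a y
    ¬ay ay = no-triangle (GirthAtLeast-mono (m≤n+m 4 1) girth) aw wy (edge-sym ay)

    ¬by : ¬ Edge G b y
    ¬by by = w≢b (common-neighbour-unique girth (≢-sym y≢a) aw wy ab by)

  module _ (girth : GirthAtLeast G 6) {u v w : Fin n} (uv : Edge G u v)
           (¬uw : ¬ Edge G u w) (¬vw : ¬ Edge G v w) where

    private
      w≢v : w ≢ v
      w≢v = non-neighbour-≢ ¬uw uv

      u≢w : u ≢ w
      u≢w = ≢-sym (non-neighbour-≢ ¬vw (edge-sym uv))

      u≢ : ∀ {y} → Edge G w y → u ≢ y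
      u≢ = non-neighbour-≢ (¬uw ∘ edge-sym)

      v≢ : ∀ {y} → Edge G w y → v ≢ y
      v≢ = non-neighbour-≢ (¬vw ∘ edge-sym)

      girth₅ : GirthAtLeast G 5
      girth₅ = GirthAtLeast-mono (m≤n+m 5 1) girth

    neighbour-in-N[u]∪N[v]-unique : ∀ {y₁ y₂} → Edge G w y₁ → Edge G w y₂ →
                                    Edge G u y₁ ⊎ Edge G v y₁ → Edge G u y₂ ⊎ Edge G v y₂ → y₁ ≡ y₂
    neighbour-in-N[u]∪N[v]-unique wy₁ wy₂ (inj₁ uy₁) (inj₁ uy₂) =
      common-neighbour-unique girth₅ u≢w uy₁ (edge-sym wy₁) uy₂ (edge-sym wy₂)
    neighbour-in-N[u]∪N[v]-unique wy₁ wy₂ (inj₂ vy₁) (inj₂ vy₂) =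
      common-neighbour-unique girth₅ (≢-sym w≢v) vy₁ (edge-sym wy₁) vy₂ (edge-sym wy₂)
    neighbour-in-N[u]∪N[v]-unique {y₁} {y₂} wy₁ wy₂ (inj₁ uy₁) (inj₂ vy₂) with y₁ ≟ y₂
    ... | yes y₁≡y₂ = y₁≡y₂
    ... | no y₁≢y₂ = ⊥-elim (no-pentagon girth uy₁ (edge-sym wy₁) wy₂ (edge-sym vy₂) (edge-sym uv)
                               u≢w (u≢ wy₂) y₁≢y₂ (≢-sym (v≢ wy₁)) w≢v)
    neighbour-in-N[u]∪N[v]-unique wy₁ wy₂ (inj₂ vy₁) (inj₁ uy₂) =
      ≡.sym (neighbour-in-N[u]∪N[v]-unique wy₂ wy₁ (inj₁ uy₂) (inj₂ vy₁))

    far-neighbour-of-far : 2 ≤ deg G w → ∃[ y ] Edge G w y × ¬ Edge G u y × ¬ Edge G v y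
    far-neighbour-of-far 2≤deg
      with y₁ , wy₁ , _      ← other-neighbour 2≤deg w
      with y₂ , wy₂ , y₂≢y₁ ← other-neighbour 2≤deg y₁
      with edge? u y₁ ⊎-dec edge? v y₁ | edge? u y₂ ⊎-dec edge? v y₂
    ... | no ¬near₁ | _         = y₁ , wy₁ , ¬near₁ ∘ inj₁ , ¬near₁ ∘ inj₂
    ... | yes _     | no ¬near₂ = y₂ , wy₂ , ¬near₂ ∘ inj₁ , ¬near₂ ∘ inj₂
    ... | yes near₁ | yes near₂ = ⊥-elim (y₂≢y₁ (neighbour-in-N[u]∪N[v]-unique wy₂ wy₁ near₂ near₁))

module TR2DF-of-edge {n} (G : Graph n) (girth : GirthAtLeast G 6) (2≤deg : ∀ w → 2 ≤ deg G w)
                     {u v : Fin n} (uv : Edge G u v) where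

  private
    girth₄ : GirthAtLeast G 4
    girth₄ = GirthAtLeast-mono G (m≤n+m 4 2) girth

    girth₅ : GirthAtLeast G 5
    girth₅ = GirthAtLeast-mono G (m≤n+m 5 1) girth

  Near : Fin n → Set
  Near w = (Edge G u w × w ≢ v) ⊎ (Edge G v w × w ≢ u)

  near? : ∀ w → Dec (Near w)
  near? w = (edge? G u w ×-dec ¬? (w ≟ v)) ⊎-dec (edge? G v w ×-dec ¬? (w ≟ u))

  -- Opaque so that a `with` on `w ≟ u` cannot reach the copy hidden inside `near? w`.
  opaque
    f : Fin n → Fin 3
    f w with near? w
    ... | yes _ = 0F
    ... | no  _ = 1F

    Near⇒f≡0 : ∀ {w} → Near w → f w ≡ 0F
    Near⇒f≡0 {w} near with near? w
    ... | yes _     = refl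
    ... | no  ¬near = contradiction near ¬near

    ¬Near⇒f≡1 : ∀ {w} → ¬ Near w → f w ≡ 1F
    ¬Near⇒f≡1 {w} ¬near with near? w
    ... | yes near = contradiction near ¬near
    ... | no  _    = refl

    f≡0⇒Near : ∀ {w} → f w ≡ 0F → Near w
    f≡0⇒Near {w} with near? w
    ... | yes near = λ _ → near
    ... | no  _    = λ ()

  ¬Near⇒f≢0 : ∀ {w} → ¬ Near w → f w ≢ 0F
  ¬Near⇒f≢0 ¬near = ¬near ∘ f≡0⇒Near

  ¬Near-u : ¬ Near u
  ¬Near-u (inj₁ (uu , _))  = edge-≢ G uu refl
  ¬Near-u (inj₂ (_ , u≢u)) = u≢u refl

  ¬Near-v : ¬ Near v
  ¬Near-v (inj₁ (_ , v≢v)) = v≢v refl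
  ¬Near-v (inj₂ (vv , _))  = edge-≢ G vv refl

  ¬Near-far : ∀ {w} → ¬ Edge G u w → ¬ Edge G v w → ¬ Near w
  ¬Near-far ¬uw _   (inj₁ (uw , _)) = ¬uw uw
  ¬Near-far _   ¬vw (inj₂ (vw , _)) = ¬vw vw

  ¬Near-cases : ∀ {w} → ¬ Near w → w ≡ u ⊎ w ≡ v ⊎ (¬ Edge G u w × ¬ Edge G v w)
  ¬Near-cases {w} ¬near with w ≟ u | w ≟ v
  ... | yes w≡u | _       = inj₁ w≡u
  ... | no  _   | yes w≡v = inj₂ (inj₁ w≡v)
  ... | no  w≢u | no  w≢v =
    inj₂ (inj₂ ((λ uw → ¬near (inj₁ (uw , w≢v))) , (λ vw → ¬near (inj₂ (vw , w≢u)))))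

  isTR2DF : IsTR2DF G f
  isTR2DF = dominating , total
    where
    dominating : ∀ w → f w ≡ 0F →
                 (∃[ x ] Edge G w x × f x ≡ 2F) ⊎
                 (∃[ x ] ∃[ y ] x ≢ y × Edge G w x × Edge G w y × f x ≡ 1F × f y ≡ 1F)
    dominating w fw≡0 with f≡0⇒Near fw≡0
    ... | inj₁ (uw , w≢v)
      with y , wy , y≢u , ¬uy , ¬vy ← far-neighbour-of-near G girth₅ (2≤deg w) uv uw w≢v
      = inj₂ (u , y , ≢-sym y≢u , edge-sym G uw , wy ,
              ¬Near⇒f≡1 ¬Near-u , ¬Near⇒f≡1 (¬Near-far ¬uy ¬vy))
    ... | inj₂ (vw , w≢u)
      with y , wy , y≢v , ¬vy , ¬uy ← far-neighbour-of-near G girth₅ (2≤deg w) (edge-sym G uv) vw w≢u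
      = inj₂ (v , y , ≢-sym y≢v , edge-sym G vw , wy ,
              ¬Near⇒f≡1 ¬Near-v , ¬Near⇒f≡1 (¬Near-far ¬uy ¬vy))

    total : ∀ w → f w ≢ 0F → ∃[ x ] Edge G w x × f x ≢ 0F
    total w fw≢0 with ¬Near-cases (fw≢0 ∘ Near⇒f≡0)
    ... | inj₁ refl                = v , uv , ¬Near⇒f≢0 ¬Near-v
    ... | inj₂ (inj₁ refl)         = u , edge-sym G uv , ¬Near⇒f≢0 ¬Near-u
    ... | inj₂ (inj₂ (¬uw , ¬vw))
      with y , wy , ¬uy , ¬vy ← far-neighbour-of-far G girth uv ¬uw ¬vw (2≤deg w)
      = y , wy , ¬Near⇒f≢0 (¬Near-far ¬uy ¬vy)

  weight-f+degrees-pointwise : ∀ w → toℕ (f w) + (𝟙 (adj G u w) + 𝟙 (adj G v w))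
                                     ≡ 1 + (𝟙 (does (w ≟ u)) + 𝟙 (does (w ≟ v)))
  weight-f+degrees-pointwise w with w ≟ u | w ≟ v
  ... | yes refl | yes u≡v = ⊥-elim (edge-≢ G uv u≡v)
  ... | yes refl | no  _   rewrite ¬Near⇒f≡1 ¬Near-u | irrefl G u | edge-sym G uv = refl
  ... | no  _    | yes refl rewrite ¬Near⇒f≡1 ¬Near-v | irrefl G v | uv = refl
  ... | no  w≢u  | no  w≢v with adj G u w in uw | adj G v w in vw
  ...   | true  | true  = ⊥-elim (no-triangle G girth₄ uw (edge-sym G vw) (edge-sym G uv))
  ...   | true  | false rewrite Near⇒f≡0 (inj₁ (uw , w≢v)) = refl
  ...   | false | true  rewrite Near⇒f≡0 (inj₂ (vw , w≢u)) = refl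
  ...   | false | false rewrite ¬Near⇒f≡1 (¬Near-far (not-¬ uw) (not-¬ vw)) = refl

  weight-f+degrees : weight f + (deg G u + deg G v) ≡ n + 2
  weight-f+degrees = begin
      weight f + (deg G u + deg G v)
    ≡⟨ cong₂ _+_ (sum-map-allFin (toℕ ∘ f)) (cong₂ _+_ (deg≡∑ G u) (deg≡∑ G v)) ⟩
      ∑ (toℕ ∘ f) + (∑[ w < n ] 𝟙 (adj G u w) + ∑[ w < n ] 𝟙 (adj G v w))
    ≡⟨ ∑-distrib-+₃ (toℕ ∘ f) (𝟙 ∘ adj G u) (𝟙 ∘ adj G v) ⟨
      ∑[ w < n ] (toℕ (f w) + (𝟙 (adj G u w) + 𝟙 (adj G v w)))
    ≡⟨ sum-cong-≗ weight-f+degrees-pointwise ⟩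
      ∑[ w < n ] (1 + (𝟙 (does (w ≟ u)) + 𝟙 (does (w ≟ v))))
    ≡⟨ ∑-distrib-+₃ (λ _ → 1) (λ w → 𝟙 (does (w ≟ u))) (λ w → 𝟙 (does (w ≟ v))) ⟩
      ∑[ w < n ] 1 + (∑[ w < n ] 𝟙 (does (w ≟ u)) + ∑[ w < n ] 𝟙 (does (w ≟ v)))
    ≡⟨ cong₂ _+_ (∑-const-1 n) (cong₂ _+_ (∑-indicator u) (∑-indicator v)) ⟩
      n + 2 ∎
    where open ≡-Reasoning

mainTheorem14 : ∀ (n : ℕ) (G : Graph n) (δ Δ γ : ℕ) →
    2 ≤ n → Connected G → GirthAtLeast G 6 →
    IsMinDegree G δ → 2 ≤ δ → IsMaxDegree G Δ →
    IsGammaTR2 G γ → γ + (Δ + δ) ≡ n + 2 →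
    ∀ (u : Fin n) → deg G u ≡ Δ → ∀ (v : Fin n) → Edge G u v → deg G v ≡ δ
mainTheorem14 n G δ Δ γ _ _ girth (δ≤deg , _) 2≤δ _ (_ , γ-minimal) γ+Δ+δ≡n+2 u deg-u≡Δ v uv =
  ≤-antisym (+-cancelˡ-≤ Δ _ _ (+-cancelˡ-≤ (weight f) _ _ bound)) (δ≤deg v)
  where
  open TR2DF-of-edge G girth (λ w → ≤-trans 2≤δ (δ≤deg w)) uv
  open ≤-Reasoning
  bound : weight f + (Δ + deg G v) ≤ weight f + (Δ + δ)
  bound = begin
      weight f + (Δ + deg G v)        ≡⟨ cong (λ d → weight f + (d + deg G v)) deg-u≡Δ ⟨
      weight f + (deg G u + deg G v)  ≡⟨ weight-f+degrees ⟩
      n + 2                           ≡⟨ γ+Δ+δ≡n+2 ⟨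
      γ + (Δ + δ)                     ≤⟨ +-monoˡ-≤ (Δ + δ) (γ-minimal f isTR2DF) ⟩
      weight f + (Δ + δ)              ∎
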